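{- Let $\lambda$ be a nonzero real number. For all integers $n,k\ge 0$ with $n\ge k$, \[ S_{2,\lambda}(n,k)=\sum_{m=k}^{n}S_{J,\lambda}^{(2)}(m,k)\,S_{1,\lambda}(n,m). \]
   Context: For a nonzero real $\lambda$, set $(x)_{0,\lambda}=1$ and $(x)_{n,\lambda}=x(x-\lambda)\cdots(x-(n-1)\lambda)$ for $n\ge1$. Let $e_\lambda^x(t)=\sum_{n\ge0}(x)_{n,\lambda}\frac{t^n}{n!}=(1+\lambda t)^{x/\lambda}$ and $e_\lambda(t)=e_\lambda^1(t)$. Let $\log_\lambda$ be the compositional inverse of $e_\lambda$, so that $\log_\lambda(1+t)=\frac{1}{\lambda}\big((1+t)^\lambda-1\big)$. The degenerate Stirling numbers of the first kind are defined by $\frac{1}{k!}(\log_\lambda(1+t))^k=\sum_{n\ge k}S_{1,\lambda}(n,k)\frac{t^n}{n!}$, those of the second kind by $\frac{1}{k!}(e_\lambda(t)-1)^k=\sum_{n\ge k}S_{2,\lambda}(n,k)\frac{t^n}{n!}$, and the Jindalrae-Stirling numbers of the second kind by $\frac{1}{k!}\big(e_\lambda(e_\lambda(t)-1)-1\big)^k=\sum_{n\ge k}S_{J,\lambda}^{(2)}(n,k)\frac{t^n}{n!}$ (all for $k\ge0$, as formal power series in $t$). -}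

module Defs where

open import Algebra.Bundles using (CommutativeRing)
open import Data.Bool using (if_then_else_)
open import Data.Nat using (ℕ; zero; suc; _∸_; _≡ᵇ_) renaming (_+_ to _+ℕ_)
open import Data.Nat.Combinatorics using (_C_)

-- A formal power series is represented by its exponential-generating-
-- function coefficient sequence  f : ℕ → R  (f n = coefficient of t^n/n!).
module Stirling {c ℓ} (R : CommutativeRing c ℓ) (lam : CommutativeRing.Carrier R) where
  open CommutativeRing R

  ι : ℕ → Carrier
  ι zero    = 0#
  ι (suc n) = 1# + ι n

  sumBelow : ℕ → (ℕ → Carrier) → Carrier
  sumBelow zero    f = 0#
  sumBelow (suc n) f = sumBelow n f + f n

  -- Σ_{m=k}^{n} f m   (empty sum 0# if n < k)
  sumFromTo : ℕ → ℕ → (ℕ → Carrier) → Carrier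
  sumFromTo k n f = sumBelow (suc n ∸ k) (λ i → f (k +ℕ i))

  fall : Carrier → Carrier → ℕ → Carrier
  fall x μ zero    = 1#
  fall x μ (suc n) = fall x μ n * (x - ι n * μ)

  dfall : Carrier → ℕ → Carrier
  dfall x n = fall x lam n

  -- Partial Bell polynomials / "k-th power divided by k!":
  -- for an EGF f with zero constant term (f 0 is never used),
  --   bell f n k = n-th EGF coefficient of f(t)^k / k!.
  -- Since division by k! is unavailable in a general ring, this is defined
  -- by the derivative identity  d/dt (f^k/k!) = f'(t) · f^(k-1)/(k-1)!,
  -- i.e.  B(0,k) = [k = 0],  B(n+1,0) = 0,
  --       B(n+1,k+1) = Σ_{j=0}^{n} C(n,j) f(n-j+1) B(j,k).
  -- (course-of-values recursion: 'table n' is correct on rows 0..n)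
  module _ (f : ℕ → Carrier) where
    row0 : ℕ → Carrier
    row0 zero    = 1#
    row0 (suc k) = 0#

    newRow : ℕ → (ℕ → ℕ → Carrier) → ℕ → Carrier
    newRow n tbl zero    = 0#
    newRow n tbl (suc k) =
      sumBelow (suc n) (λ j → ι (n C j) * f (suc (n ∸ j)) * tbl j k)

    table : ℕ → ℕ → ℕ → Carrier
    table zero    j = row0
    table (suc n) j = if j ≡ᵇ suc n then newRow n (table n) else table n j

    bell : ℕ → ℕ → Carrier
    bell n k = table n n k

  -- EGF coefficients of e_λ(t) - 1 = Σ_{n≥1} (1)_{n,λ} t^n/n!
  eλm1 : ℕ → Carrier
  eλm1 zero    = 0#
  eλm1 (suc n) = dfall 1# (suc n)

  -- EGF coefficients of log_λ(1+t) = ((1+t)^λ - 1)/λ = Σ_{n≥1} ((λ)_n/λ) t^n/n!,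
  -- where (λ)_n/λ = (λ-1)(λ-2)...(λ-(n-1))
  logλ1p : ℕ → Carrier
  logλ1p zero    = 0#
  logλ1p (suc n) = fall (lam - 1#) 1# n

  -- EGF coefficients of e_λ(e_λ(t)-1) - 1 : composition of the EGF
  -- Σ_j (1)_{j,λ} u^j/j! with u = e_λ(t)-1, minus the constant term 1
  jind : ℕ → Carrier
  jind zero    = 0#
  jind (suc n) = sumFromTo 1 (suc n) (λ j → dfall 1# j * bell eλm1 (suc n) j)

  S1 : ℕ → ℕ → Carrier
  S1 = bell logλ1p

  S2 : ℕ → ℕ → Carrier
  S2 = bell eλm1

  SJ : ℕ → ℕ → Carrier
  SJ = bell jind

module Submission where

-- Since bell f n k is the n-th coefficient of f^k/k!, the composite of
-- exponential generating functions, (a ∘ f)(t) = Σ_m a_m f(t)^m/m!, satisfies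
-- (g ∘ f)^k/k! = (g^k/k!) ∘ f, and composition is associative.  The generating
-- function of S_{J,λ}^{(2)}(·,k) is the k-th divided power of (e_λ - 1) ∘ (e_λ - 1);
-- composing it with log_λ(1+t) and using e_λ(log_λ(1+t)) = 1 + t gives
-- (e_λ(t) - 1)^k/k!, while the n-th coefficient of the composite is the right-hand
-- side of the identity.  The inversion formula comes from a differential equation:
-- h(t) = e_λ(log_λ(1+t)) satisfies (1+t)h' = h, because (1+λt)e_λ' = e_λ and
-- (1+t)(log_λ(1+t))' = 1 + λ log_λ(1+t), and the only power-series solutions of
-- (1+t)h' = h are the multiples of 1+t.

open import Algebra.Bundles using (CommutativeRing)
open import Data.Bool using (true; false)
open import Data.Nat
  using (ℕ; zero; suc; _≤_; _<_; _∸_; _≡ᵇ_; z≤n; s≤s) renaming (_+_ to _+ℕ_)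
open import Data.Nat.Properties
  using ( ≤-refl; ≤-trans; ≤-<-trans; ≤-pred; m≤n⇒m≤1+n; m≤n⇒m<n∨m≡n; n≤1+n
        ; +-∸-assoc; m+[n∸m]≡n )
open import Data.Nat.Combinatorics using (_C_; nCk+nC[k+1]≡[n+1]C[k+1]; k>n⇒nCk≡0)
open import Data.Sum using (inj₁; inj₂)
open import Relation.Binary.PropositionalEquality as ≡ using (_≡_)
open import Relation.Nullary using (¬_)

open import Defs

≡ᵇ-refl : ∀ n → (n ≡ᵇ n) ≡ true
≡ᵇ-refl zero    = ≡.refl
≡ᵇ-refl (suc n) = ≡ᵇ-refl n

<⇒≡ᵇ-false : ∀ {m n} → m < n → (m ≡ᵇ n) ≡ false
<⇒≡ᵇ-false {zero}  (s≤s _)   = ≡.refl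
<⇒≡ᵇ-false {suc m} (s≤s m<n) = <⇒≡ᵇ-false m<n

-- Nothing here depends on lam; it is a parameter only because sumBelow, ι and
-- bell are defined inside Stirling R lam.
module PowerSeries {c ℓ} (R : CommutativeRing c ℓ) (lam : CommutativeRing.Carrier R) where

  open CommutativeRing R hiding (zero)
  open Stirling R lam
  open import Algebra.Properties.CommutativeSemigroup +-commutativeSemigroup
    using (interchange; x∙yz≈y∙xz; xy∙z≈x∙zy)
  open import Algebra.Properties.AbelianGroup +-abelianGroup using (identityˡ-unique)
  open import Relation.Binary.Reasoning.Setoid setoid

  Series : Set c
  Series = ℕ → Carrier

  infix 4 _≋_
  _≋_ : Series → Series → Set ℓ
  a ≋ b = ∀ n → a n ≈ b n

  sumBelow-cong-< : ∀ n {f g : Series} → (∀ i → i < n → f i ≈ g i) → sumBelow n f ≈ sumBelow n g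
  sumBelow-cong-< zero    f≈g = refl
  sumBelow-cong-< (suc n) f≈g =
    +-cong (sumBelow-cong-< n (λ i i<n → f≈g i (m≤n⇒m≤1+n i<n))) (f≈g n ≤-refl)

  sumBelow-cong : ∀ n {f g : Series} → f ≋ g → sumBelow n f ≈ sumBelow n g
  sumBelow-cong n f≈g = sumBelow-cong-< n (λ i _ → f≈g i)

  sumBelow-≈0 : ∀ n {f : Series} → (∀ i → i < n → f i ≈ 0#) → sumBelow n f ≈ 0#
  sumBelow-≈0 zero    f≈0 = refl
  sumBelow-≈0 (suc n) f≈0 =
    trans (+-cong (sumBelow-≈0 n (λ i i<n → f≈0 i (m≤n⇒m≤1+n i<n))) (f≈0 n ≤-refl)) (+-identityʳ 0#)

  sumBelow-+ : ∀ n (f g : Series) → sumBelow n (λ i → f i + g i) ≈ sumBelow n f + sumBelow n g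
  sumBelow-+ zero    f g = sym (+-identityʳ 0#)
  sumBelow-+ (suc n) f g = trans (+-congʳ (sumBelow-+ n f g)) (interchange _ _ _ _)

  sumBelow-*ˡ : ∀ n x (f : Series) → x * sumBelow n f ≈ sumBelow n (λ i → x * f i)
  sumBelow-*ˡ zero    x f = zeroʳ x
  sumBelow-*ˡ (suc n) x f = trans (distribˡ x _ _) (+-congʳ (sumBelow-*ˡ n x f))

  sumBelow-*ʳ : ∀ n x (f : Series) → sumBelow n f * x ≈ sumBelow n (λ i → f i * x)
  sumBelow-*ʳ zero    x f = zeroˡ x
  sumBelow-*ʳ (suc n) x f = trans (distribʳ x _ _) (+-congʳ (sumBelow-*ʳ n x f))

  sumBelow-suc : ∀ n (f : Series) → sumBelow (suc n) f ≈ f 0 + sumBelow n (λ i → f (suc i))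
  sumBelow-suc zero    f = trans (+-identityˡ _) (sym (+-identityʳ _))
  sumBelow-suc (suc n) f = trans (+-congʳ (sumBelow-suc n f)) (+-assoc _ _ _)

  sumBelow-comm : ∀ m n (f : ℕ → ℕ → Carrier) →
    sumBelow m (λ i → sumBelow n (f i)) ≈ sumBelow n (λ j → sumBelow m (λ i → f i j))
  sumBelow-comm zero    n f = sym (sumBelow-≈0 n (λ _ _ → refl))
  sumBelow-comm (suc m) n f = trans (+-congʳ (sumBelow-comm m n f)) (sym (sumBelow-+ n _ _))

  sumBelow-extend : ∀ {m n} (f : Series) → m ≤ n → (∀ i → m ≤ i → f i ≈ 0#) →
                    sumBelow n f ≈ sumBelow m f
  sumBelow-extend {n = zero}  f z≤n     _   = refl
  sumBelow-extend {n = suc n} f m≤1+n f≈0 with m≤n⇒m<n∨m≡n m≤1+n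
  ... | inj₂ ≡.refl    = refl
  ... | inj₁ (s≤s m≤n) = trans (+-cong (sumBelow-extend f m≤n f≈0) (f≈0 n m≤n)) (+-identityʳ _)

  sumBelow-drop : ∀ k n (f : Series) → (∀ i → i < k → f i ≈ 0#) →
                  sumBelow (k +ℕ n) f ≈ sumBelow n (λ i → f (k +ℕ i))
  sumBelow-drop zero    n f _   = refl
  sumBelow-drop (suc k) n f f≈0 = begin
    sumBelow (suc k +ℕ n) f
      ≈⟨ sumBelow-suc (k +ℕ n) f ⟩
    f 0 + sumBelow (k +ℕ n) (λ i → f (suc i))
      ≈⟨ +-cong (f≈0 0 (s≤s z≤n)) (sumBelow-drop k n _ (λ i i<k → f≈0 (suc i) (s≤s i<k))) ⟩
    0# + sumBelow n (λ i → f (suc k +ℕ i))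
      ≈⟨ +-identityˡ _ ⟩
    sumBelow n (λ i → f (suc k +ℕ i))
      ∎

  sumFromTo≈sumBelow : ∀ {k n} (f : Series) → k ≤ suc n → (∀ i → i < k → f i ≈ 0#) →
                       sumFromTo k n f ≈ sumBelow (suc n) f
  sumFromTo≈sumBelow {k} {n} f k≤1+n f≈0 = begin
    sumBelow (suc n ∸ k) (λ i → f (k +ℕ i))  ≈⟨ sumBelow-drop k (suc n ∸ k) f f≈0 ⟨
    sumBelow (k +ℕ (suc n ∸ k)) f            ≡⟨ ≡.cong (λ m → sumBelow m f) (m+[n∸m]≡n k≤1+n) ⟩
    sumBelow (suc n) f                       ∎

  ι-+ : ∀ m n → ι (m +ℕ n) ≈ ι m + ι n
  ι-+ zero    n = sym (+-identityˡ _)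
  ι-+ (suc m) n = trans (+-congˡ (ι-+ m n)) (sym (+-assoc _ _ _))

  module _ (f : Series) where

    private
      table-stable : ∀ {j n} → j ≤ n → table f n j ≡ table f j j
      table-stable {n = zero} z≤n = ≡.refl
      table-stable {j} {suc n} j≤1+n with m≤n⇒m<n∨m≡n j≤1+n
      ... | inj₂ ≡.refl   = ≡.refl
      ... | inj₁ j<1+n rewrite <⇒≡ᵇ-false j<1+n = table-stable (≤-pred j<1+n)

      bell-suc : ∀ n → bell f (suc n) ≡ newRow f n (table f n)
      bell-suc n rewrite ≡ᵇ-refl n = ≡.refl

    bell-suc-zero : ∀ n → bell f (suc n) 0 ≡ 0#
    bell-suc-zero n = ≡.cong (λ row → row 0) (bell-suc n)

    bell-suc-suc : ∀ n k →
      bell f (suc n) (suc k) ≈ sumBelow (suc n) (λ j → ι (n C j) * f (suc (n ∸ j)) * bell f j k)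
    bell-suc-suc n k = begin
      bell f (suc n) (suc k)
        ≡⟨ ≡.cong (λ row → row (suc k)) (bell-suc n) ⟩
      sumBelow (suc n) (λ j → ι (n C j) * f (suc (n ∸ j)) * table f n j k)
        ≈⟨ sumBelow-cong-< (suc n) (λ j j<1+n → reflexive (≡.cong (λ row → ι (n C j) * f (suc (n ∸ j)) * row k)
                                                                 (table-stable (≤-pred j<1+n)))) ⟩
      sumBelow (suc n) (λ j → ι (n C j) * f (suc (n ∸ j)) * bell f j k)
        ∎

  D : Series → Series
  D a n = a (suc n)

  infixl 6 _⊞_
  _⊞_ : Series → Series → Series
  (a ⊞ b) n = a n + b n

  infixr 8 _·_
  _·_ : Carrier → Series → Series
  (x · a) n = x * a n

  𝟘 𝟙 X : Series
  𝟘 _ = 0#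
  𝟙 zero    = 1#
  𝟙 (suc _) = 0#
  -- X is the series t; defining it through 𝟙 makes D X and 𝟙 definitionally equal.
  X zero    = 0#
  X (suc n) = 𝟙 n

  -- The product of exponential generating functions, determined by its
  -- constant term and the Leibniz rule (a b)' = a' b + a b'.
  infixl 7 _⊠_
  _⊠_ : Series → Series → Series
  (a ⊠ b) zero    = a 0 * b 0
  (a ⊠ b) (suc n) = (D a ⊠ b) n + (a ⊠ D b) n

  ⊠-cong-≤ : ∀ n {a a′ b b′} → (∀ j → j ≤ n → a j ≈ a′ j) → (∀ j → j ≤ n → b j ≈ b′ j) →
             (a ⊠ b) n ≈ (a′ ⊠ b′) n
  ⊠-cong-≤ zero    a≈a′ b≈b′ = *-cong (a≈a′ 0 z≤n) (b≈b′ 0 z≤n)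
  ⊠-cong-≤ (suc n) a≈a′ b≈b′ = +-cong
    (⊠-cong-≤ n (λ j j≤n → a≈a′ (suc j) (s≤s j≤n)) (λ j j≤n → b≈b′ j (m≤n⇒m≤1+n j≤n)))
    (⊠-cong-≤ n (λ j j≤n → a≈a′ j (m≤n⇒m≤1+n j≤n)) (λ j j≤n → b≈b′ (suc j) (s≤s j≤n)))

  ⊠-cong : ∀ {a a′ b b′} → a ≋ a′ → b ≋ b′ → a ⊠ b ≋ a′ ⊠ b′
  ⊠-cong a≈a′ b≈b′ n = ⊠-cong-≤ n (λ j _ → a≈a′ j) (λ j _ → b≈b′ j)

  ⊠-congˡ : ∀ {a a′} b → a ≋ a′ → a ⊠ b ≋ a′ ⊠ b
  ⊠-congˡ b a≈a′ = ⊠-cong a≈a′ (λ _ → refl)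

  ⊠-congʳ : ∀ a {b b′} → b ≋ b′ → a ⊠ b ≋ a ⊠ b′
  ⊠-congʳ a b≈b′ = ⊠-cong (λ _ → refl) b≈b′

  ⊠-comm : ∀ a b → a ⊠ b ≋ b ⊠ a
  ⊠-comm a b zero    = *-comm (a 0) (b 0)
  ⊠-comm a b (suc n) = trans (+-cong (⊠-comm (D a) b n) (⊠-comm a (D b) n)) (+-comm _ _)

  ⊠-zeroˡ : ∀ b → 𝟘 ⊠ b ≋ 𝟘
  ⊠-zeroˡ b zero    = zeroˡ (b 0)
  ⊠-zeroˡ b (suc n) = trans (+-cong (⊠-zeroˡ b n) (⊠-zeroˡ (D b) n)) (+-identityʳ 0#)

  ⊠-identityˡ : ∀ a → 𝟙 ⊠ a ≋ a
  ⊠-identityˡ a zero    = *-identityˡ (a 0)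
  ⊠-identityˡ a (suc n) = trans (+-cong (⊠-zeroˡ a n) (⊠-identityˡ (D a) n)) (+-identityˡ _)

  ⊠-identityʳ : ∀ a → a ⊠ 𝟙 ≋ a
  ⊠-identityʳ a n = trans (⊠-comm a 𝟙 n) (⊠-identityˡ a n)

  ⊠-distribʳ : ∀ a b c → (a ⊞ b) ⊠ c ≋ a ⊠ c ⊞ b ⊠ c
  ⊠-distribʳ a b c zero    = distribʳ (c 0) (a 0) (b 0)
  ⊠-distribʳ a b c (suc n) =
    trans (+-cong (⊠-distribʳ (D a) (D b) c n) (⊠-distribʳ a b (D c) n)) (interchange _ _ _ _)

  ⊠-distribˡ : ∀ a b c → a ⊠ (b ⊞ c) ≋ a ⊠ b ⊞ a ⊠ c
  ⊠-distribˡ a b c n = begin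
    (a ⊠ (b ⊞ c)) n          ≈⟨ ⊠-comm a (b ⊞ c) n ⟩
    ((b ⊞ c) ⊠ a) n          ≈⟨ ⊠-distribʳ b c a n ⟩
    (b ⊠ a) n + (c ⊠ a) n    ≈⟨ +-cong (⊠-comm b a n) (⊠-comm c a n) ⟩
    (a ⊠ b) n + (a ⊠ c) n    ∎

  ·-⊠ : ∀ x a b → (x · a) ⊠ b ≋ x · (a ⊠ b)
  ·-⊠ x a b zero    = *-assoc x (a 0) (b 0)
  ·-⊠ x a b (suc n) = trans (+-cong (·-⊠ x (D a) b n) (·-⊠ x a (D b) n)) (sym (distribˡ x _ _))

  ⊠-· : ∀ x a b → a ⊠ (x · b) ≋ x · (a ⊠ b)
  ⊠-· x a b n = trans (⊠-comm a (x · b) n) (trans (·-⊠ x b a n) (*-congˡ (⊠-comm b a n)))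

  ⊠-assoc : ∀ a b c → (a ⊠ b) ⊠ c ≋ a ⊠ (b ⊠ c)
  ⊠-assoc a b c zero    = *-assoc (a 0) (b 0) (c 0)
  ⊠-assoc a b c (suc n) = begin
    ((D a ⊠ b ⊞ a ⊠ D b) ⊠ c) n + (a ⊠ b ⊠ D c) n
      ≈⟨ +-congʳ (⊠-distribʳ (D a ⊠ b) (a ⊠ D b) c n) ⟩
    ((D a ⊠ b) ⊠ c) n + ((a ⊠ D b) ⊠ c) n + ((a ⊠ b) ⊠ D c) n
      ≈⟨ +-cong (+-cong (⊠-assoc (D a) b c n) (⊠-assoc a (D b) c n)) (⊠-assoc a b (D c) n) ⟩
    (D a ⊠ (b ⊠ c)) n + (a ⊠ (D b ⊠ c)) n + (a ⊠ (b ⊠ D c)) n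
      ≈⟨ +-assoc _ _ _ ⟩
    (D a ⊠ (b ⊠ c)) n + ((a ⊠ (D b ⊠ c)) n + (a ⊠ (b ⊠ D c)) n)
      ≈⟨ +-congˡ (⊠-distribˡ a (D b ⊠ c) (b ⊠ D c) n) ⟨
    (D a ⊠ (b ⊠ c)) n + (a ⊠ (D b ⊠ c ⊞ b ⊠ D c)) n
      ∎

  X⊠D : ∀ h n → (X ⊠ D h) n ≈ ι n * h n
  X⊠D h zero    = trans (zeroˡ _) (sym (zeroˡ _))
  X⊠D h (suc n) = begin
    (𝟙 ⊠ D h) n + (X ⊠ D (D h)) n      ≈⟨ +-cong (⊠-identityˡ (D h) n) (X⊠D (D h) n) ⟩
    h (suc n) + ι n * h (suc n)        ≈⟨ +-congʳ (*-identityˡ _) ⟨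
    1# * h (suc n) + ι n * h (suc n)   ≈⟨ distribʳ _ _ _ ⟨
    ι (suc n) * h (suc n)              ∎

  ι[nCk]*y*x≈0 : ∀ {n k} y x → n < k → ι (n C k) * y * x ≈ 0#
  ι[nCk]*y*x≈0 {n} {k} y x n<k = begin
    ι (n C k) * y * x   ≡⟨ ≡.cong (λ m → ι m * y * x) (k>n⇒nCk≡0 n<k) ⟩
    0# * y * x          ≈⟨ trans (*-congʳ (zeroˡ y)) (zeroˡ x) ⟩
    0#                  ∎

  ι-pascal : ∀ n k y x → ι (n C k) * y * x + ι (n C suc k) * y * x ≈ ι (suc n C suc k) * y * x
  ι-pascal n k y x = begin
    ι (n C k) * y * x + ι (n C suc k) * y * x   ≈⟨ distribʳ x _ _ ⟨
    (ι (n C k) * y + ι (n C suc k) * y) * x     ≈⟨ *-congʳ (distribʳ y _ _) ⟨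
    (ι (n C k) + ι (n C suc k)) * y * x         ≈⟨ *-congʳ (*-congʳ (ι-+ (n C k) (n C suc k))) ⟨
    ι (n C k +ℕ n C suc k) * y * x              ≡⟨ ≡.cong (λ m → ι m * y * x) (nCk+nC[k+1]≡[n+1]C[k+1] n k) ⟩
    ι (suc n C suc k) * y * x                   ∎

  ⊠-binomial : ∀ a b n → (a ⊠ b) n ≈ sumBelow (suc n) (λ j → ι (n C j) * b (n ∸ j) * a j)
  ⊠-binomial a b zero = begin
    a 0 * b 0              ≈⟨ *-comm _ _ ⟩
    b 0 * a 0              ≈⟨ *-congʳ (*-identityˡ _) ⟨
    1# * b 0 * a 0         ≈⟨ *-congʳ (*-congʳ (+-identityʳ 1#)) ⟨
    ι 1 * b 0 * a 0        ≈⟨ +-identityˡ _ ⟨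
    0# + ι 1 * b 0 * a 0   ∎
  ⊠-binomial a b (suc n) = begin
    (D a ⊠ b) n + (a ⊠ D b) n
      ≈⟨ +-cong (⊠-binomial (D a) b n) (⊠-binomial a (D b) n) ⟩
    S (n C_) + sumBelow (suc n) (λ j → ι (n C j) * b (suc (n ∸ j)) * a j)
      ≈⟨ +-congˡ shifted ⟩
    S (n C_) + (head + S (λ j → n C suc j))
      ≈⟨ x∙yz≈y∙xz _ _ _ ⟩
    head + (S (n C_) + S (λ j → n C suc j))
      ≈⟨ +-congˡ (sumBelow-+ (suc n) _ _) ⟨
    head + sumBelow (suc n) (λ j → ι (n C j) * b (n ∸ j) * a (suc j) + ι (n C suc j) * b (n ∸ j) * a (suc j))
      ≈⟨ +-congˡ (sumBelow-cong (suc n) (λ j → ι-pascal n j _ _)) ⟩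
    head + S (λ j → suc n C suc j)
      ≈⟨ sumBelow-suc (suc n) _ ⟨
    sumBelow (suc (suc n)) (λ j → ι (suc n C j) * b (suc n ∸ j) * a j)
      ∎
    where
      S : (ℕ → ℕ) → Carrier
      S c = sumBelow (suc n) (λ j → ι (c j) * b (n ∸ j) * a (suc j))

      head : Carrier
      head = ι 1 * b (suc n) * a 0

      shifted : sumBelow (suc n) (λ j → ι (n C j) * b (suc (n ∸ j)) * a j) ≈ head + S (λ j → n C suc j)
      shifted = begin
        sumBelow (suc n) (λ j → ι (n C j) * b (suc (n ∸ j)) * a j)
          ≈⟨ sumBelow-suc n _ ⟩
        head + sumBelow n (λ j → ι (n C suc j) * b (suc (n ∸ suc j)) * a (suc j))
          ≈⟨ +-congˡ (sumBelow-cong-< n (λ j j<n →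
               reflexive (≡.cong (λ m → ι (n C suc j) * b m * a (suc j)) (≡.sym (+-∸-assoc 1 j<n))))) ⟩
        head + sumBelow n (λ j → ι (n C suc j) * b (n ∸ j) * a (suc j))
          ≈⟨ +-congˡ (sumBelow-extend _ (n≤1+n n) (λ j n≤j → ι[nCk]*y*x≈0 _ _ (s≤s n≤j))) ⟨
        head + S (λ j → n C suc j)
          ∎

  divPow : Series → ℕ → Series
  divPow f k n = bell f n k

  divPow-zero : ∀ f → divPow f 0 ≋ 𝟙
  divPow-zero f zero    = refl
  divPow-zero f (suc n) = reflexive (bell-suc-zero f n)

  divPow-suc : ∀ f k → D (divPow f (suc k)) ≋ divPow f k ⊠ D f
  divPow-suc f k n = trans (bell-suc-suc f n k) (sym (⊠-binomial (divPow f k) (D f) n))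

  divPow-cong : ∀ {f g} → f ≋ g → ∀ k → divPow f k ≋ divPow g k
  divPow-cong f≈g zero    n       = trans (divPow-zero _ n) (sym (divPow-zero _ n))
  divPow-cong f≈g (suc k) zero    = refl
  divPow-cong {f} {g} f≈g (suc k) (suc n) = begin
    divPow f (suc k) (suc n)      ≈⟨ divPow-suc f k n ⟩
    (divPow f k ⊠ D f) n          ≈⟨ ⊠-cong (divPow-cong f≈g k) (λ j → f≈g (suc j)) n ⟩
    (divPow g k ⊠ D g) n          ≈⟨ divPow-suc g k n ⟨
    divPow g (suc k) (suc n)      ∎

  n<k⇒bell≈0 : ∀ f {n k} → n < k → bell f n k ≈ 0#
  n<k⇒bell≈0 f {n} = bounded n ≤-refl
    where
      bounded : ∀ N {n k} → n ≤ N → n < k → bell f n k ≈ 0#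
      bounded N       {zero}  {suc k} _         _         = refl
      bounded (suc N) {suc n} {suc k} (s≤s n≤N) (s≤s n<k) = begin
        bell f (suc n) (suc k)
          ≈⟨ divPow-suc f k n ⟩
        (divPow f k ⊠ D f) n
          ≈⟨ ⊠-cong-≤ n (λ j j≤n → bounded N (≤-trans j≤n n≤N) (≤-<-trans j≤n n<k)) (λ _ _ → refl) ⟩
        (𝟘 ⊠ D f) n
          ≈⟨ ⊠-zeroˡ (D f) n ⟩
        0#
          ∎

  ⊠-left-comm : ∀ a b c → a ⊠ (b ⊠ c) ≋ b ⊠ (a ⊠ c)
  ⊠-left-comm a b c n =
    trans (sym (⊠-assoc a b c n)) (trans (⊠-congˡ c (⊠-comm a b) n) (⊠-assoc b a c n))

  ⊠-right-comm : ∀ a b c → a ⊠ b ⊠ c ≋ a ⊠ c ⊠ b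
  ⊠-right-comm a b c n =
    trans (⊠-assoc a b c n) (trans (⊠-congʳ a (⊠-comm b c) n) (sym (⊠-assoc a c b n)))

  infixr 9 _⊚_
  _⊚_ : Series → Series → Series
  (a ⊚ f) n = sumBelow (suc n) (λ m → a m * bell f n m)

  ⊚-extend : ∀ a f {n N} → n < N → (a ⊚ f) n ≈ sumBelow N (λ m → a m * bell f n m)
  ⊚-extend a f n<N =
    sym (sumBelow-extend _ n<N (λ m n<m → trans (*-congˡ (n<k⇒bell≈0 f n<m)) (zeroʳ _)))

  ⊚-congˡ : ∀ {a a′} f → a ≋ a′ → a ⊚ f ≋ a′ ⊚ f
  ⊚-congˡ f a≈a′ n = sumBelow-cong (suc n) (λ m → *-congʳ (a≈a′ m))

  ⊚-congʳ : ∀ a {f f′} → f ≋ f′ → a ⊚ f ≋ a ⊚ f′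
  ⊚-congʳ a f≈f′ n = sumBelow-cong (suc n) (λ m → *-congˡ (divPow-cong f≈f′ m n))

  ⊚-zero : ∀ a f → (a ⊚ f) 0 ≈ a 0
  ⊚-zero a f = trans (+-identityˡ _) (*-identityʳ _)

  ⊚-distribʳ : ∀ a b f → (a ⊞ b) ⊚ f ≋ a ⊚ f ⊞ b ⊚ f
  ⊚-distribʳ a b f n = trans (sumBelow-cong (suc n) (λ m → distribʳ _ _ _)) (sumBelow-+ (suc n) _ _)

  ·-⊚ : ∀ x a f → (x · a) ⊚ f ≋ x · (a ⊚ f)
  ·-⊚ x a f n = trans (sumBelow-cong (suc n) (λ m → *-assoc _ _ _)) (sym (sumBelow-*ˡ (suc n) x _))

  sumBelow-⊠ : ∀ N (c : Series) (g : ℕ → Series) b →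
    (λ j → sumBelow N (λ m → c m * g m j)) ⊠ b ≋ (λ n → sumBelow N (λ m → c m * (g m ⊠ b) n))
  sumBelow-⊠ zero    c g b n = ⊠-zeroˡ b n
  sumBelow-⊠ (suc N) c g b n =
    trans (⊠-distribʳ _ _ b n) (+-cong (sumBelow-⊠ N c g b n) (·-⊠ (c N) (g N) b n))

  ⊚-chain : ∀ a f → D (a ⊚ f) ≋ (D a ⊚ f) ⊠ D f
  ⊚-chain a f n = begin
    sumBelow (suc (suc n)) (λ m → a m * bell f (suc n) m)
      ≈⟨ sumBelow-suc (suc n) _ ⟩
    a 0 * bell f (suc n) 0 + sumBelow (suc n) (λ m → a (suc m) * bell f (suc n) (suc m))
      ≈⟨ +-cong (trans (*-congˡ (reflexive (bell-suc-zero f n))) (zeroʳ _))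
                (sumBelow-cong (suc n) (λ m → *-congˡ (divPow-suc f m n))) ⟩
    0# + sumBelow (suc n) (λ m → D a m * (divPow f m ⊠ D f) n)
      ≈⟨ +-identityˡ _ ⟩
    sumBelow (suc n) (λ m → D a m * (divPow f m ⊠ D f) n)
      ≈⟨ sumBelow-⊠ (suc n) (D a) (divPow f) (D f) n ⟨
    ((λ j → sumBelow (suc n) (λ m → D a m * bell f j m)) ⊠ D f) n
      ≈⟨ ⊠-cong-≤ n (λ j j≤n → ⊚-extend (D a) f (s≤s j≤n)) (λ _ _ → refl) ⟨
    (D a ⊚ f ⊠ D f) n
      ∎

  𝟙-⊚ : ∀ f → 𝟙 ⊚ f ≋ 𝟙
  𝟙-⊚ f n = begin
    (𝟙 ⊚ f) n
      ≈⟨ sumBelow-suc n _ ⟩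
    1# * bell f n 0 + sumBelow n (λ m → 0# * bell f n (suc m))
      ≈⟨ +-cong (*-identityˡ _) (sumBelow-≈0 n (λ m _ → zeroˡ _)) ⟩
    bell f n 0 + 0#
      ≈⟨ +-identityʳ _ ⟩
    divPow f 0 n
      ≈⟨ divPow-zero f n ⟩
    𝟙 n
      ∎

  ⊠-⊚ : ∀ a b f → (a ⊠ b) ⊚ f ≋ (a ⊚ f) ⊠ (b ⊚ f)
  ⊠-⊚ a b f n = bounded n ≤-refl a b
    where
      bounded : ∀ {n} N → n ≤ N → ∀ a b → ((a ⊠ b) ⊚ f) n ≈ ((a ⊚ f) ⊠ (b ⊚ f)) n
      bounded {zero}  N       _         a b =
        trans (⊚-zero (a ⊠ b) f) (sym (*-cong (⊚-zero a f) (⊚-zero b f)))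
      bounded {suc n} (suc N) (s≤s n≤N) a b = begin
        ((a ⊠ b) ⊚ f) (suc n)
          ≈⟨ ⊚-chain (a ⊠ b) f n ⟩
        ((D a ⊠ b ⊞ a ⊠ D b) ⊚ f ⊠ D f) n
          ≈⟨ ⊠-cong-≤ n (λ j j≤n → trans (⊚-distribʳ _ _ f j)
               (+-cong (bounded N (≤-trans j≤n n≤N) (D a) b) (bounded N (≤-trans j≤n n≤N) a (D b))))
               (λ _ _ → refl) ⟩
        ((D a ⊚ f ⊠ B ⊞ A ⊠ D b ⊚ f) ⊠ D f) n
          ≈⟨ ⊠-distribʳ _ _ (D f) n ⟩
        (D a ⊚ f ⊠ B ⊠ D f) n + (A ⊠ D b ⊚ f ⊠ D f) n
          ≈⟨ +-cong (⊠-right-comm (D a ⊚ f) B (D f) n) (⊠-assoc A (D b ⊚ f) (D f) n) ⟩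
        (D a ⊚ f ⊠ D f ⊠ B) n + (A ⊠ (D b ⊚ f ⊠ D f)) n
          ≈⟨ +-cong (⊠-congˡ B (⊚-chain a f) n) (⊠-congʳ A (⊚-chain b f) n) ⟨
        (D A ⊠ B) n + (A ⊠ D B) n
          ∎
        where
          A B : Series
          A = a ⊚ f
          B = b ⊚ f

  divPow-⊚ : ∀ g f k → divPow (g ⊚ f) k ≋ divPow g k ⊚ f
  divPow-⊚ g f zero n = begin
    divPow (g ⊚ f) 0 n   ≈⟨ divPow-zero (g ⊚ f) n ⟩
    𝟙 n                  ≈⟨ 𝟙-⊚ f n ⟨
    (𝟙 ⊚ f) n            ≈⟨ ⊚-congˡ f (divPow-zero g) n ⟨
    (divPow g 0 ⊚ f) n   ∎
  divPow-⊚ g f (suc k) zero    = sym (⊚-zero (divPow g (suc k)) f)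
  divPow-⊚ g f (suc k) (suc n) = begin
    divPow (g ⊚ f) (suc k) (suc n)
      ≈⟨ divPow-suc (g ⊚ f) k n ⟩
    (divPow (g ⊚ f) k ⊠ D (g ⊚ f)) n
      ≈⟨ ⊠-cong (divPow-⊚ g f k) (⊚-chain g f) n ⟩
    (divPow g k ⊚ f ⊠ (D g ⊚ f ⊠ D f)) n
      ≈⟨ ⊠-assoc _ _ _ n ⟨
    (divPow g k ⊚ f ⊠ D g ⊚ f ⊠ D f) n
      ≈⟨ ⊠-congˡ (D f) (⊠-⊚ (divPow g k) (D g) f) n ⟨
    ((divPow g k ⊠ D g) ⊚ f ⊠ D f) n
      ≈⟨ ⊠-congˡ (D f) (⊚-congˡ f (divPow-suc g k)) n ⟨
    (D (divPow g (suc k)) ⊚ f ⊠ D f) n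
      ≈⟨ ⊚-chain (divPow g (suc k)) f n ⟨
    (divPow g (suc k) ⊚ f) (suc n)
      ∎

  ⊚-assoc : ∀ a g f → a ⊚ (g ⊚ f) ≋ (a ⊚ g) ⊚ f
  ⊚-assoc a g f n = begin
    sumBelow (suc n) (λ m → a m * divPow (g ⊚ f) m n)
      ≈⟨ sumBelow-cong (suc n) (λ m → *-congˡ (divPow-⊚ g f m n)) ⟩
    sumBelow (suc n) (λ m → a m * sumBelow (suc n) (λ j → bell g j m * bell f n j))
      ≈⟨ sumBelow-cong (suc n) (λ m → sumBelow-*ˡ (suc n) (a m) _) ⟩
    sumBelow (suc n) (λ m → sumBelow (suc n) (λ j → a m * (bell g j m * bell f n j)))
      ≈⟨ sumBelow-comm (suc n) (suc n) _ ⟩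
    sumBelow (suc n) (λ j → sumBelow (suc n) (λ m → a m * (bell g j m * bell f n j)))
      ≈⟨ sumBelow-cong (suc n) (λ j → trans (sumBelow-cong (suc n) (λ m → sym (*-assoc _ _ _)))
                                            (sym (sumBelow-*ʳ (suc n) _ _))) ⟩
    sumBelow (suc n) (λ j → sumBelow (suc n) (λ m → a m * bell g j m) * bell f n j)
      ≈⟨ sumBelow-cong-< (suc n) (λ j j<1+n → *-congʳ (⊚-extend a g j<1+n)) ⟨
    sumBelow (suc n) (λ j → (a ⊚ g) j * bell f n j)
      ∎

  ⊚-identityʳ : ∀ a → a ⊚ X ≋ a
  ⊚-identityʳ a zero    = ⊚-zero a X
  ⊚-identityʳ a (suc n) = begin
    (a ⊚ X) (suc n)   ≈⟨ ⊚-chain a X n ⟩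
    (D a ⊚ X ⊠ 𝟙) n   ≈⟨ ⊠-identityʳ (D a ⊚ X) n ⟩
    (D a ⊚ X) n       ≈⟨ ⊚-identityʳ (D a) n ⟩
    a (suc n)         ∎

  ⊚-identityˡ : ∀ f → f 0 ≈ 0# → X ⊚ f ≋ f
  ⊚-identityˡ f f₀≈0 zero    = trans (⊚-zero X f) (sym f₀≈0)
  ⊚-identityˡ f f₀≈0 (suc n) = begin
    (X ⊚ f) (suc n)   ≈⟨ ⊚-chain X f n ⟩
    (𝟙 ⊚ f ⊠ D f) n   ≈⟨ ⊠-congˡ (D f) (𝟙-⊚ f) n ⟩
    (𝟙 ⊠ D f) n       ≈⟨ ⊠-identityˡ (D f) n ⟩
    f (suc n)         ∎

  [1+X]D : Series → Series
  [1+X]D h = D h ⊞ X ⊠ D h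

  [1+X]D≋id⇒D≋const : ∀ {h} → [1+X]D h ≋ h → D h ≋ h 0 · 𝟙
  [1+X]D≋id⇒D≋const {h} ode zero    = begin
    h 1                  ≈⟨ +-identityʳ _ ⟨
    h 1 + 0#             ≈⟨ +-congˡ (zeroˡ (h 1)) ⟨
    h 1 + (X ⊠ D h) 0    ≈⟨ ode 0 ⟩
    h 0                  ≈⟨ *-identityʳ _ ⟨
    h 0 * 1#             ∎
  [1+X]D≋id⇒D≋const {h} ode (suc n) = trans (vanish n) (sym (zeroʳ (h 0)))
    where
      recurrence : ∀ n → h (2 +ℕ n) + ι n * h (1 +ℕ n) ≈ 0#
      recurrence n = identityˡ-unique _ (h (1 +ℕ n)) (begin
        h (2 +ℕ n) + ι n * h (1 +ℕ n) + h (1 +ℕ n)          ≈⟨ xy∙z≈x∙zy _ _ _ ⟩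
        h (2 +ℕ n) + (h (1 +ℕ n) + ι n * h (1 +ℕ n))        ≈⟨ +-congˡ (+-congʳ (*-identityˡ _)) ⟨
        h (2 +ℕ n) + (1# * h (1 +ℕ n) + ι n * h (1 +ℕ n))   ≈⟨ +-congˡ (distribʳ _ _ _) ⟨
        h (2 +ℕ n) + ι (suc n) * h (1 +ℕ n)                 ≈⟨ +-congˡ (X⊠D h (suc n)) ⟨
        h (2 +ℕ n) + (X ⊠ D h) (suc n)                      ≈⟨ ode (suc n) ⟩
        h (1 +ℕ n)                                          ∎)

      previous≈0 : ∀ n → ι n * h (1 +ℕ n) ≈ 0#

      vanish : ∀ n → h (2 +ℕ n) ≈ 0#
      vanish n = begin
        h (2 +ℕ n)                      ≈⟨ +-identityʳ _ ⟨
        h (2 +ℕ n) + 0#                 ≈⟨ +-congˡ (previous≈0 n) ⟨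
        h (2 +ℕ n) + ι n * h (1 +ℕ n)   ≈⟨ recurrence n ⟩
        0#                              ∎

      previous≈0 zero    = zeroˡ _
      previous≈0 (suc n) = trans (*-congˡ (vanish n)) (zeroʳ _)

module Degenerate {c ℓ} (R : CommutativeRing c ℓ) (lam : CommutativeRing.Carrier R) where

  open CommutativeRing R hiding (zero)
  open Stirling R lam
  open PowerSeries R lam
  open import Algebra.Properties.AbelianGroup +-abelianGroup using (⁻¹-∙-comm)
  open import Relation.Binary.Reasoning.Setoid setoid

  x*[y-z]+z*x≈x*y : ∀ x y z → x * (y - z) + z * x ≈ x * y
  x*[y-z]+z*x≈x*y x y z = begin
    x * (y - z) + z * x    ≈⟨ +-congˡ (*-comm z x) ⟩
    x * (y - z) + x * z    ≈⟨ distribˡ x _ _ ⟨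
    x * (y - z + z)        ≈⟨ *-congˡ (+-assoc y (- z) z) ⟩
    x * (y + (- z + z))    ≈⟨ *-congˡ (+-congˡ (-‿inverseˡ z)) ⟩
    x * (y + 0#)           ≈⟨ *-congˡ (+-identityʳ y) ⟩
    x * y                  ∎

  eλ : Series
  eλ = dfall 1#

  eλ-ode : D eλ ⊞ lam · (X ⊠ D eλ) ≋ eλ
  eλ-ode n = begin
    eλ n * (1# - ι n * lam) + lam * (X ⊠ D eλ) n   ≈⟨ +-congˡ (*-congˡ (X⊠D eλ n)) ⟩
    eλ n * (1# - ι n * lam) + lam * (ι n * eλ n)   ≈⟨ +-congˡ (trans (sym (*-assoc _ _ _)) (*-congʳ (*-comm _ _))) ⟩
    eλ n * (1# - ι n * lam) + ι n * lam * eλ n     ≈⟨ x*[y-z]+z*x≈x*y _ _ _ ⟩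
    eλ n * 1#                                      ≈⟨ *-identityʳ _ ⟩
    eλ n                                           ∎

  logλ1p-ode : [1+X]D logλ1p ≋ 𝟙 ⊞ lam · logλ1p
  logλ1p-ode zero    = trans (+-congˡ (zeroˡ 1#)) (sym (+-congˡ (zeroʳ lam)))
  logλ1p-ode (suc n) = begin
    F (suc n) + (X ⊠ D logλ1p) (suc n)                 ≈⟨ +-congˡ (X⊠D logλ1p (suc n)) ⟩
    F n * (lam - 1# - ι n * 1#) + (1# + ι n) * F n     ≈⟨ +-congʳ (*-congˡ subtrahends) ⟩
    F n * (lam - (1# + ι n)) + (1# + ι n) * F n        ≈⟨ x*[y-z]+z*x≈x*y _ _ _ ⟩
    F n * lam                                          ≈⟨ *-comm _ _ ⟩
    lam * F n                                          ≈⟨ +-identityˡ _ ⟨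
    0# + lam * F n                                     ∎
    where
      F : Series
      F = fall (lam - 1#) 1#

      subtrahends : lam - 1# - ι n * 1# ≈ lam - (1# + ι n)
      subtrahends = begin
        lam - 1# - ι n * 1#       ≈⟨ +-congˡ (-‿cong (*-identityʳ (ι n))) ⟩
        lam - 1# - ι n            ≈⟨ +-assoc lam (- 1#) (- ι n) ⟩
        lam + (- 1# - ι n)        ≈⟨ +-congˡ (⁻¹-∙-comm 1# (ι n)) ⟩
        lam - (1# + ι n)          ∎

  eλ⊚logλ1p-ode : [1+X]D (eλ ⊚ logλ1p) ≋ eλ ⊚ logλ1p
  eλ⊚logλ1p-ode n = begin
    D (eλ ⊚ L) n + (X ⊠ D (eλ ⊚ L)) n
      ≈⟨ +-cong (⊚-chain eλ L n) (⊠-congʳ X (⊚-chain eλ L) n) ⟩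
    (G ⊠ D L) n + (X ⊠ (G ⊠ D L)) n
      ≈⟨ +-congˡ (⊠-left-comm X G (D L) n) ⟩
    (G ⊠ D L) n + (G ⊠ (X ⊠ D L)) n
      ≈⟨ ⊠-distribˡ G (D L) (X ⊠ D L) n ⟨
    (G ⊠ [1+X]D L) n
      ≈⟨ ⊠-congʳ G logλ1p-ode n ⟩
    (G ⊠ (𝟙 ⊞ lam · L)) n
      ≈⟨ ⊠-distribˡ G 𝟙 (lam · L) n ⟩
    (G ⊠ 𝟙) n + (G ⊠ lam · L) n
      ≈⟨ +-cong (⊠-identityʳ G n) (⊠-· lam G L n) ⟩
    G n + lam * (G ⊠ L) n
      ≈⟨ +-congˡ (*-congˡ X⊠Deλ⊚L) ⟨
    G n + lam * ((X ⊠ D eλ) ⊚ L) n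
      ≈⟨ trans (⊚-distribʳ (D eλ) (lam · (X ⊠ D eλ)) L n) (+-congˡ (·-⊚ lam (X ⊠ D eλ) L n)) ⟨
    ((D eλ ⊞ lam · (X ⊠ D eλ)) ⊚ L) n
      ≈⟨ ⊚-congˡ L eλ-ode n ⟩
    (eλ ⊚ L) n
      ∎
    where
      L G : Series
      L = logλ1p
      G = D eλ ⊚ L

      X⊠Deλ⊚L : ((X ⊠ D eλ) ⊚ L) n ≈ (G ⊠ L) n
      X⊠Deλ⊚L = begin
        ((X ⊠ D eλ) ⊚ L) n   ≈⟨ ⊠-⊚ X (D eλ) L n ⟩
        (X ⊚ L ⊠ G) n        ≈⟨ ⊠-congˡ G (⊚-identityˡ L refl) n ⟩
        (L ⊠ G) n            ≈⟨ ⊠-comm L G n ⟩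
        (G ⊠ L) n            ∎

  -- D eλm1 and D eλ are definitionally equal.
  eλm1⊚logλ1p≋X : eλm1 ⊚ logλ1p ≋ X
  eλm1⊚logλ1p≋X zero    = ⊚-zero eλm1 logλ1p
  eλm1⊚logλ1p≋X (suc n) = begin
    (eλm1 ⊚ logλ1p) (suc n)        ≈⟨ ⊚-chain eλm1 logλ1p n ⟩
    (D eλ ⊚ logλ1p ⊠ D logλ1p) n   ≈⟨ ⊚-chain eλ logλ1p n ⟨
    D (eλ ⊚ logλ1p) n              ≈⟨ [1+X]D≋id⇒D≋const eλ⊚logλ1p-ode n ⟩
    (eλ ⊚ logλ1p) 0 * 𝟙 n          ≈⟨ *-congʳ (⊚-zero eλ logλ1p) ⟩
    1# * 𝟙 n                       ≈⟨ *-identityˡ _ ⟩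
    X (suc n)                      ∎

  jind≋eλm1⊚eλm1 : jind ≋ eλm1 ⊚ eλm1
  jind≋eλm1⊚eλm1 zero    = sym (⊚-zero eλm1 eλm1)
  jind≋eλm1⊚eλm1 (suc n) = sym (begin
    (eλm1 ⊚ eλm1) (suc n)                      ≈⟨ sumBelow-suc (suc n) _ ⟩
    0# * bell eλm1 (suc n) 0 + jind (suc n)    ≈⟨ +-congʳ (zeroˡ _) ⟩
    0# + jind (suc n)                          ≈⟨ +-identityˡ _ ⟩
    jind (suc n)                               ∎)

  jind⊚logλ1p≋eλm1 : jind ⊚ logλ1p ≋ eλm1
  jind⊚logλ1p≋eλm1 n = begin
    (jind ⊚ logλ1p) n            ≈⟨ ⊚-congˡ logλ1p jind≋eλm1⊚eλm1 n ⟩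
    ((eλm1 ⊚ eλm1) ⊚ logλ1p) n   ≈⟨ ⊚-assoc eλm1 eλm1 logλ1p n ⟨
    (eλm1 ⊚ eλm1 ⊚ logλ1p) n     ≈⟨ ⊚-congʳ eλm1 eλm1⊚logλ1p≋X n ⟩
    (eλm1 ⊚ X) n                 ≈⟨ ⊚-identityʳ eλm1 n ⟩
    eλm1 n                       ∎

theorem2 : ∀ {c ℓ} (R : CommutativeRing c ℓ) (lam : CommutativeRing.Carrier R) →
    ¬ (CommutativeRing._≈_ R lam (CommutativeRing.0# R)) →
    (n k : ℕ) → k ≤ n →
    CommutativeRing._≈_ R (Stirling.S2 R lam n k)
      (Stirling.sumFromTo R lam k n
        (λ m → CommutativeRing._*_ R (Stirling.SJ R lam m k) (Stirling.S1 R lam n m)))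
theorem2 R lam _ n k k≤n = sym (begin
    sumFromTo k n (λ m → SJ m k * S1 n m)
      ≈⟨ sumFromTo≈sumBelow _ (m≤n⇒m≤1+n k≤n) (λ m m<k → trans (*-congʳ (n<k⇒bell≈0 jind m<k)) (zeroˡ _)) ⟩
    (divPow jind k ⊚ logλ1p) n
      ≈⟨ divPow-⊚ jind logλ1p k n ⟨
    divPow (jind ⊚ logλ1p) k n
      ≈⟨ divPow-cong jind⊚logλ1p≋eλm1 k n ⟩
    S2 n k
      ∎)
  where
    open CommutativeRing R
    open Stirling R lam
    open PowerSeries R lam
    open Degenerate R lam
    open import Relation.Binary.Reasoning.Setoid setoid
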